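{- Let $G_1$ and $G_2$ be graphs on $n_1$ and $n_2$ vertices, respectively. For $j\in\{1,2\}$, let $I_j$ be the number of isolated vertices of $G_j$ if $n_j>1$, and $I_j=0$ if $n_j=1$. Let $G=G_1\vee G_2$. Then $$\mathcal{P}(G;x)=\left(1+\frac{I_1}{x}\right)\mathcal{P}(G_1;x)+\left(1+\frac{I_2}{x}\right)\mathcal{P}(G_2;x)+\big((x+1)^{n_1}-1\big)\big((x+1)^{n_2}-1\big).$$
   Context: Graphs are finite and simple with nonempty vertex set. The join $G_1\vee G_2$ is obtained from the disjoint union of $G_1$ and $G_2$ by adding all edges between a vertex of $G_1$ and a vertex of $G_2$. For $S\subseteq V(G)$, $S$ is a power dominating set if, after coloring $S$, coloring every neighbor of a vertex of $S$, and then repeatedly applying the forcing rule (a colored vertex with exactly one uncolored neighbor colors that neighbor) until no changes occur, all vertices are colored. $\mathcal{P}(G;x)=\sum_{i=1}^{n} p(G;i)x^i$, where $p(G;i)$ is the number of power dominating sets of size $i$ and $n$ is the order of $G$. -}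

module Defs where

open import Data.Nat using (ℕ; zero; suc; _+_; _*_; _∸_; _^_; _≤_; _≡ᵇ_)
open import Data.Bool using (Bool; true; false; _∧_; _∨_; not; if_then_else_)
open import Data.Fin using (Fin; splitAt)
open import Data.Sum using (_⊎_; inj₁; inj₂)
open import Data.Bool.ListAction using (any; all)
open import Data.List using (List; []; _∷_; _++_; map; allFin; filterᵇ; length; sum; upTo)
open import Data.Vec using (Vec; []; _∷_; lookup)
open import Function using (_∘_)
open import Relation.Binary.PropositionalEquality using (_≡_; refl)

record Graph : Set where
  field
    n        : ℕ
    nonempty : 1 ≤ n
    adj      : Fin n → Fin n → Bool
    adj-sym  : ∀ u v → adj u v ≡ adj v u
    adj-irr  : ∀ v → adj v v ≡ false
open Graph public

-- Join: vertices of G1 are the first n1 elements of Fin (n1 + n2).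
joinAdj : ∀ {n₁ n₂} → (Fin n₁ → Fin n₁ → Bool) → (Fin n₂ → Fin n₂ → Bool)
        → Fin (n₁ + n₂) → Fin (n₁ + n₂) → Bool
joinAdj {n₁} a₁ a₂ u v with splitAt n₁ u | splitAt n₁ v
... | inj₁ x | inj₁ y = a₁ x y
... | inj₂ x | inj₂ y = a₂ x y
... | inj₁ _ | inj₂ _ = true
... | inj₂ _ | inj₁ _ = true

private
  lemma-1≤ : ∀ a b → 1 ≤ a → 1 ≤ a + b
  lemma-1≤ (suc a) b (Data.Nat.s≤s _) = Data.Nat.s≤s Data.Nat.z≤n

_∨ᴳ_ : Graph → Graph → Graph
G₁ ∨ᴳ G₂ = record
  { n = n G₁ + n G₂
  ; nonempty = lemma-1≤ (n G₁) (n G₂) (nonempty G₁)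
  ; adj = joinAdj (adj G₁) (adj G₂)
  ; adj-sym = sym'
  ; adj-irr = irr'
  }
  where
  sym' : ∀ u v → joinAdj (adj G₁) (adj G₂) u v ≡ joinAdj (adj G₁) (adj G₂) v u
  sym' u v with splitAt (n G₁) u | splitAt (n G₁) v
  ... | inj₁ x | inj₁ y = adj-sym G₁ x y
  ... | inj₂ x | inj₂ y = adj-sym G₂ x y
  ... | inj₁ _ | inj₂ _ = refl
  ... | inj₂ _ | inj₁ _ = refl
  irr' : ∀ v → joinAdj (adj G₁) (adj G₂) v v ≡ false
  irr' v with splitAt (n G₁) v
  ... | inj₁ x = adj-irr G₁ x
  ... | inj₂ x = adj-irr G₂ x

countᵇ : ∀ {A : Set} → (A → Bool) → List A → ℕ
countᵇ p xs = length (filterᵇ p xs)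

-- Vertex subsets (and colorings) as Bool-valued functions / vectors.
module _ (G : Graph) where
  private
    V = Fin (n G)
    vs = allFin (n G)

  domStep : (V → Bool) → (V → Bool)
  domStep S u = S u ∨ any (λ v → S v ∧ adj G v u) vs

  uncoloredNbrs : (V → Bool) → V → ℕ
  uncoloredNbrs C v = countᵇ (λ u → adj G v u ∧ not (C u)) vs

  -- one (parallel) round of the forcing rule: a colored vertex with exactly one
  -- uncolored neighbor colors that neighbor
  forceStep : (V → Bool) → (V → Bool)
  forceStep C u = C u ∨ any (λ v → C v ∧ adj G v u ∧ (uncoloredNbrs C v ≡ᵇ 1)) vs

  iterateN : ℕ → (V → Bool) → (V → Bool)
  iterateN zero    C = C
  iterateN (suc k) C = iterateN k (forceStep C)

  -- Each non-stationary round colors at least one new vertex, so after n rounds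
  -- no further changes occur: this is the final colored set.
  finalColored : (V → Bool) → (V → Bool)
  finalColored S = iterateN (n G) (domStep S)

  isPowerDominating : (V → Bool) → Bool
  isPowerDominating S = all (finalColored S) vs

subsets : (m : ℕ) → List (Vec Bool m)
subsets zero = [] ∷ []
subsets (suc m) = map (true ∷_) (subsets m) ++ map (false ∷_) (subsets m)

size : ∀ {m} → Vec Bool m → ℕ
size [] = 0
size (true ∷ s) = suc (size s)
size (false ∷ s) = size s

p : Graph → ℕ → ℕ
p G i = countᵇ (λ S → isPowerDominating G (lookup S) ∧ (size S ≡ᵇ i)) (subsets (n G))

Σ1to : ℕ → (ℕ → ℕ) → ℕ
Σ1to zero f = 0
Σ1to (suc m) f = Σ1to m f + f (suc m)

𝒫 : Graph → ℕ → ℕ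
𝒫 G x = Σ1to (n G) (λ i → p G i * x ^ i)

-- 𝒫(G;x)/x = Σ_{i=1}^{n} p(G;i) x^(i-1)   (exact, since the sum starts at i = 1)
𝒫/x : Graph → ℕ → ℕ
𝒫/x G x = Σ1to (n G) (λ i → p G i * x ^ (i ∸ 1))

isolatedCount : Graph → ℕ
isolatedCount G = countᵇ (λ v → not (any (adj G v) (allFin (n G)))) (allFin (n G))

I : Graph → ℕ
I G = if n G ≡ᵇ 1 then 0 else isolatedCount G

module Submission where

-- 𝒫(G;x) is a sum over the vertex subsets S of G of [S power dominating]·x^|S|
-- (Σ1to-p).  A subset of G₁ ∨ G₂ is a pair s ∪ t with s ⊆ V(G₁), t ⊆ V(G₂).
-- If s and t are both nonempty, the domination step alone colours every vertex,
-- and these sets give ((x+1)^{n₁} - 1)((x+1)^{n₂} - 1).  If t = ∅ ≠ s, the set is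
-- power dominating in the join iff s is power dominating or almost power
-- dominating (leaves exactly one vertex uncoloured) in G₁ (module JoinSide);
-- symmetrically for s = ∅ ≠ t.  Adding the single uncoloured vertex, which must
-- be isolated, turns the almost power dominating sets of G₁ into the pairs
-- (w, T) of an isolated vertex w in a power dominating set T (count-completes),
-- contributing I₁·𝒫(G₁;x)/x (when n₁ = 1 there are none, matching I₁ = 0).

open import Defs
open import Data.Nat using (ℕ; zero; suc; _+_; _*_; _∸_; _^_; _≤_; _<_; z≤n; s≤s; _≡ᵇ_)
open import Data.Nat.Properties
open import Data.Bool using (Bool; true; false; _∧_; _∨_; not; T?)
open import Data.Bool.Properties using (T-≡; ∨-identityʳ; ∨-zeroʳ; ∧-zeroʳ; ∨-commutativeMonoid)
open import Data.Bool.ListAction using (any; all; or; and)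
open import Data.List using ([]; _∷_; _++_; map; tabulate; length; filterᵇ; allFin)
open import Data.List.Properties using (map-cong; filter-++; length-++)
open import Data.List.Membership.Propositional using (_∈_)
open import Data.List.Membership.Propositional.Properties using (∈-allFin)
open import Data.List.Relation.Unary.Any using (here; there)
open import Data.Vec using (Vec; []; _∷_; lookup; _[_]≔_) renaming (_++_ to _++ᵛ_)
open import Data.Vec.Properties using (lookup-++ˡ; lookup-++ʳ; lookup∘update; lookup∘update′)
open import Data.Fin using (Fin; zero; suc; _↑ˡ_; _↑ʳ_; splitAt; join)
open import Data.Fin.Properties using (splitAt-↑ˡ; splitAt-↑ʳ; join-splitAt)
  renaming (suc-injective to Fin-suc-injective; _≟_ to _≟ᶠ_)
open import Data.Product using (∃; _×_; _,_; proj₁; proj₂)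
open import Data.Sum using (_⊎_; inj₁; inj₂; swap)
open import Data.Empty using (⊥; ⊥-elim)
open import Function using (_∘_; Equivalence)
open import Relation.Nullary using (¬_; yes; no; does)
open import Relation.Nullary.Decidable using (dec-false)
open import Relation.Binary.PropositionalEquality hiding ([_])
open import Algebra.Properties.Semiring.Sum +-*-semiring
  using (sum; sum-syntax; sum-cong-≗; ∑-distrib-+; *-distribʳ-sum)
open import Algebra.Properties.CommutativeSemigroup +-commutativeSemigroup
  using (interchange)
open import Algebra.Bundles using (CommutativeMonoid)
open import Algebra.Properties.CommutativeSemigroup (CommutativeMonoid.commutativeSemigroup ∨-commutativeMonoid)
  using (xy∙z≈xz∙y)

∨-true-elim : ∀ a b → a ∨ b ≡ true → a ≡ true ⊎ b ≡ true
∨-true-elim true  b _ = inj₁ refl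
∨-true-elim false b e = inj₂ e

∨-trueˡ : ∀ a b → a ≡ true → a ∨ b ≡ true
∨-trueˡ true b _ = refl

∨-trueʳ : ∀ a b → b ≡ true → a ∨ b ≡ true
∨-trueʳ true  b _ = refl
∨-trueʳ false b e = e

∧-trueˡ : ∀ {a b} → a ∧ b ≡ true → a ≡ true
∧-trueˡ {true} _ = refl

∧-trueʳ : ∀ {a b} → a ∧ b ≡ true → b ≡ true
∧-trueʳ {true} e = e

∧-true : ∀ {a b} → a ≡ true → b ≡ true → a ∧ b ≡ true
∧-true refl refl = refl

not-true : ∀ {a} → not a ≡ true → a ≡ false
not-true {false} _ = refl

not-false : ∀ {a} → a ≡ false → not a ≡ true
not-false refl = refl

true-or-false : ∀ a → a ≡ true ⊎ a ≡ false
true-or-false true  = inj₁ refl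
true-or-false false = inj₂ refl

not-false⁻¹ : ∀ {a} → not a ≡ false → a ≡ true
not-false⁻¹ {true} _ = refl

∧-zeroʳ-mid : ∀ a {b} → a ∧ false ∧ b ≡ false
∧-zeroʳ-mid true  = refl
∧-zeroʳ-mid false = refl

true≢false : ∀ {a} → a ≡ true → a ≡ false → ⊥
true≢false refl ()

not-mono : ∀ {a b} → (a ≡ true → b ≡ true) → not b ≡ true → not a ≡ true
not-mono {false} _ _ = refl
not-mono {true}  h e = ⊥-elim (true≢false (h refl) (not-true e))

≡ᵇ-sound : ∀ m n → (m ≡ᵇ n) ≡ true → m ≡ n
≡ᵇ-sound m n e = ≡ᵇ⇒≡ m n (Equivalence.from T-≡ e)

≡ᵇ-refl : ∀ m → (m ≡ᵇ m) ≡ true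
≡ᵇ-refl m = Equivalence.to T-≡ (≡⇒≡ᵇ m m refl)

any⁺ : ∀ {A : Set} (p : A → Bool) {x xs} → x ∈ xs → p x ≡ true → any p xs ≡ true
any⁺ p {xs = y ∷ ys} (here refl) e = ∨-trueˡ (p y) _ e
any⁺ p {xs = y ∷ ys} (there x∈) e = ∨-trueʳ (p y) _ (any⁺ p x∈ e)

any⁻ : ∀ {A : Set} (p : A → Bool) xs → any p xs ≡ true → ∃ λ x → p x ≡ true
any⁻ p (y ∷ ys) e with ∨-true-elim (p y) _ e
... | inj₁ py = y , py
... | inj₂ rest = any⁻ p ys rest

any-none : ∀ {A : Set} (p : A → Bool) xs → (∀ x → p x ≡ false) → any p xs ≡ false
any-none p []       h = refl
any-none p (y ∷ ys) h rewrite h y = any-none p ys h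

any-cong : ∀ {A : Set} {p q : A → Bool} xs → (∀ x → p x ≡ q x) → any p xs ≡ any q xs
any-cong xs h = cong or (map-cong h xs)

all⁺ : ∀ {A : Set} (p : A → Bool) xs → (∀ x → p x ≡ true) → all p xs ≡ true
all⁺ p []       h = refl
all⁺ p (y ∷ ys) h rewrite h y = all⁺ p ys h

all⁻ : ∀ {A : Set} (p : A → Bool) {x xs} → all p xs ≡ true → x ∈ xs → p x ≡ true
all⁻ p {xs = y ∷ ys} e (here refl) = ∧-trueˡ e
all⁻ p {xs = y ∷ ys} e (there x∈) = all⁻ p (∧-trueʳ {p y} e) x∈

all-cong : ∀ {A : Set} {p q : A → Bool} xs → (∀ x → p x ≡ q x) → all p xs ≡ all q xs
all-cong xs h = cong and (map-cong h xs)

infixr 7.5 [_]·_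

[_]·_ : Bool → ℕ → ℕ
[ true  ]· y = y
[ false ]· y = 0

[]·-zero : ∀ b → [ b ]· 0 ≡ 0
[]·-zero true  = refl
[]·-zero false = refl

[]·-∧ : ∀ a b y → [ a ∧ b ]· y ≡ [ a ]· ([ b ]· y)
[]·-∧ true  b y = refl
[]·-∧ false b y = refl

[]·-one : ∀ b y → [ b ]· 1 * y ≡ [ b ]· y
[]·-one true  y = +-identityʳ y
[]·-one false y = refl

count : ∀ {n} → (Fin n → Bool) → ℕ
count {n} q = ∑[ i < n ] ([ q i ]· 1)

countᵇ-tabulate : ∀ {A : Set} (q : A → Bool) {n} (f : Fin n → A) →
                  countᵇ q (tabulate f) ≡ count (q ∘ f)
countᵇ-tabulate q {zero}  f = refl
countᵇ-tabulate q {suc n} f with q (f zero)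
... | true  = cong suc (countᵇ-tabulate q (f ∘ suc))
... | false = countᵇ-tabulate q (f ∘ suc)

count-cong : ∀ {n} {p q : Fin n → Bool} → (∀ i → p i ≡ q i) → count p ≡ count q
count-cong h = sum-cong-≗ (λ i → cong ([_]· 1) (h i))

count-* : ∀ {n} (q : Fin n → Bool) y → count q * y ≡ ∑[ i < n ] ([ q i ]· y)
count-* q y = trans (*-distribʳ-sum y (λ i → [ q i ]· 1)) (sum-cong-≗ (λ i → []·-one (q i) y))

count-≤ : ∀ {n} (q : Fin n → Bool) → count q ≤ n
count-≤ {zero}  q = z≤n
count-≤ {suc n} q with q zero
... | true  = s≤s (count-≤ (q ∘ suc))
... | false = m≤n⇒m≤1+n (count-≤ (q ∘ suc))

count-all : ∀ {n} (q : Fin n → Bool) → (∀ i → q i ≡ true) → count q ≡ n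
count-all {zero}  q h = refl
count-all {suc n} q h rewrite h zero = cong suc (count-all (q ∘ suc) (h ∘ suc))

count-none : ∀ {n} (q : Fin n → Bool) → (∀ i → q i ≡ false) → count q ≡ 0
count-none {zero}  q h = refl
count-none {suc n} q h rewrite h zero = count-none (q ∘ suc) (h ∘ suc)

count-pos : ∀ {n} (q : Fin n → Bool) i → q i ≡ true → 1 ≤ count q
count-pos q zero    e rewrite e = s≤s z≤n
count-pos q (suc i) e = ≤-trans (count-pos (q ∘ suc) i e) (m≤n+m _ _)

count-zero : ∀ {n} (q : Fin n → Bool) → count q ≡ 0 → ∀ i → q i ≡ false
count-zero q e i with q i in qi
... | false = refl
... | true  = ⊥-elim (0≢1+n (sym (n≤0⇒n≡0 (subst (1 ≤_) e (count-pos q i qi)))))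

count-mono : ∀ {n} {p q : Fin n → Bool} → (∀ i → p i ≡ true → q i ≡ true) → count p ≤ count q
count-mono {zero}          h = z≤n
count-mono {suc n} {p} {q} h with p zero in ep | q zero in eq
... | true  | true  = s≤s (count-mono (h ∘ suc))
... | false | true  = m≤n⇒m≤1+n (count-mono (h ∘ suc))
... | false | false = count-mono (h ∘ suc)
... | true  | false = ⊥-elim (true≢false (h zero ep) eq)

count-strict : ∀ {n} {p q : Fin n → Bool} → (∀ i → p i ≡ true → q i ≡ true) →
               ∀ u → p u ≡ false → q u ≡ true → count p < count q
count-strict {suc n} h zero pu qu rewrite pu | qu = s≤s (count-mono (h ∘ suc))
count-strict {suc n} {p} {q} h (suc u) pu qu with p zero in ep | q zero in eq
... | true  | true  = s≤s (count-strict (h ∘ suc) u pu qu)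
... | false | true  = m≤n⇒m≤1+n (count-strict (h ∘ suc) u pu qu)
... | false | false = count-strict (h ∘ suc) u pu qu
... | true  | false = ⊥-elim (true≢false (h zero ep) eq)

count-witness : ∀ {n} (q : Fin n → Bool) → 1 ≤ count q → ∃ λ i → q i ≡ true
count-witness {suc n} q h with q zero in e
... | true  = zero , e
... | false with count-witness (q ∘ suc) h
...   | i , qi = suc i , qi

count≡1⇒unique : ∀ {n} (q : Fin n → Bool) → count q ≡ 1 →
                 ∃ λ w → q w ≡ true × (∀ u → q u ≡ true → u ≡ w)
count≡1⇒unique {suc n} q e with q zero in q0
... | true = zero , q0 , only-zero
  where
  only-zero : ∀ u → q u ≡ true → u ≡ zero
  only-zero zero    _  = refl
  only-zero (suc u) qu = ⊥-elim (true≢false qu (count-zero (q ∘ suc) (suc-injective e) u))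
... | false with count≡1⇒unique (q ∘ suc) e
...   | w , qw , uniq = suc w , qw , only-w
  where
  only-w : ∀ u → q u ≡ true → u ≡ suc w
  only-w zero    qu = ⊥-elim (true≢false qu q0)
  only-w (suc u) qu = cong suc (uniq u qu)

unique⇒count≡1 : ∀ {n} (q : Fin n → Bool) w → q w ≡ true → (∀ u → q u ≡ true → u ≡ w) → count q ≡ 1
unique⇒count≡1 q zero qw uniq rewrite qw = cong suc (count-none (q ∘ suc) others)
  where
  others : ∀ u → q (suc u) ≡ false
  others u with q (suc u) in qu
  ... | false = refl
  ... | true with () ← uniq (suc u) qu
unique⇒count≡1 q (suc w) qw uniq with q zero in q0
... | false = unique⇒count≡1 (q ∘ suc) w qw (λ u qu → Fin-suc-injective (uniq (suc u) qu))
... | true with () ← uniq zero q0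

count-split : ∀ {m k} (q : Fin (m + k) → Bool) →
              count q ≡ count (q ∘ (_↑ˡ k)) + count (q ∘ (m ↑ʳ_))
count-split {zero}  q = refl
count-split {suc m} q = trans (cong ([ q zero ]· 1 +_) (count-split {m} (q ∘ suc)))
                              (sym (+-assoc ([ q zero ]· 1) _ _))

Fin1-unique : ∀ {m} → m ≡ 1 → (a b : Fin m) → a ≡ b
Fin1-unique refl zero zero = refl

-- Sums over all subsets of an m-element set, with subsets encoded as
-- Boolean vectors; the recursion mirrors the enumeration 'subsets m' of Defs.

Σsub : (m : ℕ) → (Vec Bool m → ℕ) → ℕ
Σsub zero    f = f []
Σsub (suc m) f = Σsub m (f ∘ (true ∷_)) + Σsub m (f ∘ (false ∷_))

Σsub-cong : ∀ m {f g : Vec Bool m → ℕ} → (∀ S → f S ≡ g S) → Σsub m f ≡ Σsub m g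
Σsub-cong zero    h = h []
Σsub-cong (suc m) h = cong₂ _+_ (Σsub-cong m (h ∘ (true ∷_))) (Σsub-cong m (h ∘ (false ∷_)))

Σsub-+ : ∀ m (f g : Vec Bool m → ℕ) → Σsub m (λ S → f S + g S) ≡ Σsub m f + Σsub m g
Σsub-+ zero    f g = refl
Σsub-+ (suc m) f g =
  trans (cong₂ _+_ (Σsub-+ m (f ∘ (true ∷_)) (g ∘ (true ∷_))) (Σsub-+ m (f ∘ (false ∷_)) (g ∘ (false ∷_))))
        (interchange (Σsub m (f ∘ (true ∷_))) (Σsub m (g ∘ (true ∷_)))
                     (Σsub m (f ∘ (false ∷_))) (Σsub m (g ∘ (false ∷_))))

Σsub-*ˡ : ∀ m c (f : Vec Bool m → ℕ) → Σsub m (λ S → c * f S) ≡ c * Σsub m f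
Σsub-*ˡ zero    c f = refl
Σsub-*ˡ (suc m) c f = trans (cong₂ _+_ (Σsub-*ˡ m c (f ∘ (true ∷_))) (Σsub-*ˡ m c (f ∘ (false ∷_))))
                             (sym (*-distribˡ-+ c (Σsub m (f ∘ (true ∷_))) (Σsub m (f ∘ (false ∷_)))))

Σsub-*ʳ : ∀ m c (f : Vec Bool m → ℕ) → Σsub m (λ S → f S * c) ≡ Σsub m f * c
Σsub-*ʳ zero    c f = refl
Σsub-*ʳ (suc m) c f = trans (cong₂ _+_ (Σsub-*ʳ m c (f ∘ (true ∷_))) (Σsub-*ʳ m c (f ∘ (false ∷_))))
                             (sym (*-distribʳ-+ c (Σsub m (f ∘ (true ∷_))) (Σsub m (f ∘ (false ∷_)))))

Σsub-zero : ∀ m → Σsub m (λ _ → 0) ≡ 0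
Σsub-zero zero    = refl
Σsub-zero (suc m) = cong₂ _+_ (Σsub-zero m) (Σsub-zero m)

Σsub-[]· : ∀ m b (f : Vec Bool m → ℕ) → Σsub m (λ S → [ b ]· f S) ≡ [ b ]· Σsub m f
Σsub-[]· m true  f = refl
Σsub-[]· m false f = Σsub-zero m

Σsub-∑ : ∀ m {k} (F : Vec Bool m → Fin k → ℕ) →
         Σsub m (λ S → ∑[ w < k ] F S w) ≡ ∑[ w < k ] Σsub m (λ S → F S w)
Σsub-∑ zero    F = refl
Σsub-∑ (suc m) F = trans (cong₂ _+_ (Σsub-∑ m (F ∘ (true ∷_))) (Σsub-∑ m (F ∘ (false ∷_))))
  (sym (∑-distrib-+ (λ w → Σsub m (λ S → F (true ∷ S) w)) (λ w → Σsub m (λ S → F (false ∷ S) w))))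

Σsub-split : ∀ m k (f : Vec Bool (m + k) → ℕ) →
             Σsub (m + k) f ≡ Σsub m (λ s → Σsub k (λ t → f (s ++ᵛ t)))
Σsub-split zero    k f = refl
Σsub-split (suc m) k f = cong₂ _+_ (Σsub-split m k (f ∘ (true ∷_))) (Σsub-split m k (f ∘ (false ∷_)))

Σsub-binomial : ∀ m x → Σsub m (λ S → x ^ size S) ≡ (x + 1) ^ m
Σsub-binomial zero    x = refl
Σsub-binomial (suc m) x = begin
  Σsub m (λ S → x * x ^ size S) + Σsub m (λ S → x ^ size S)
    ≡⟨ cong (_+ Σsub m (λ S → x ^ size S)) (Σsub-*ˡ m x (λ S → x ^ size S)) ⟩
  x * Σsub m (λ S → x ^ size S) + Σsub m (λ S → x ^ size S)
    ≡⟨ cong (λ y → x * y + y) (Σsub-binomial m x) ⟩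
  x * (x + 1) ^ m + (x + 1) ^ m
    ≡⟨ cong (x * (x + 1) ^ m +_) (sym (*-identityˡ _)) ⟩
  x * (x + 1) ^ m + 1 * (x + 1) ^ m
    ≡⟨ sym (*-distribʳ-+ _ x 1) ⟩
  (x + 1) * (x + 1) ^ m
    ∎
  where open ≡-Reasoning

isEmpty : ∀ {m} → Vec Bool m → Bool
isEmpty S = size S ≡ᵇ 0

Σsub-empty : ∀ m c → Σsub m (λ S → [ isEmpty S ]· c) ≡ c
Σsub-empty zero    c = refl
Σsub-empty (suc m) c = cong₂ _+_ (Σsub-zero m) (Σsub-empty m c)

Σsub-nonempty : ∀ m x → Σsub m (λ S → [ not (isEmpty S) ]· x ^ size S) ≡ (x + 1) ^ m ∸ 1
Σsub-nonempty m x = sym (begin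
  (x + 1) ^ m ∸ 1
    ≡⟨ cong (_∸ 1) (sym (Σsub-binomial m x)) ⟩
  Σsub m (λ S → x ^ size S) ∸ 1
    ≡⟨ cong (_∸ 1) (Σsub-cong m split-empty) ⟩
  Σsub m (λ S → [ isEmpty S ]· 1 + weight S) ∸ 1
    ≡⟨ cong (_∸ 1) (trans (Σsub-+ m (λ S → [ isEmpty S ]· 1) weight) (cong (_+ Σsub m weight) (Σsub-empty m 1))) ⟩
  1 + Σsub m weight ∸ 1
    ≡⟨ m+n∸m≡n 1 (Σsub m weight) ⟩
  Σsub m weight
    ∎)
  where
  open ≡-Reasoning
  weight : Vec Bool m → ℕ
  weight S = [ not (isEmpty S) ]· x ^ size S
  split-empty : ∀ S → x ^ size S ≡ [ isEmpty S ]· 1 + weight S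
  split-empty S with size S
  ... | zero  = refl
  ... | suc _ = refl

-- inserting a missing element w is a bijection from the subsets avoiding w
-- onto the subsets containing w
Σsub-insert : ∀ m (w : Fin m) (g : Vec Bool m → ℕ) →
              Σsub m (λ T → [ lookup T w ]· g T) ≡ Σsub m (λ s → [ not (lookup s w) ]· g (s [ w ]≔ true))
Σsub-insert (suc m) zero    g = +-comm (Σsub m (g ∘ (true ∷_))) (Σsub m (λ _ → 0))
Σsub-insert (suc m) (suc w) g =
  cong₂ _+_ (Σsub-insert m w (g ∘ (true ∷_))) (Σsub-insert m w (g ∘ (false ∷_)))

countᵇ-++ : ∀ {A : Set} (q : A → Bool) xs ys → countᵇ q (xs ++ ys) ≡ countᵇ q xs + countᵇ q ys
countᵇ-++ q xs ys = trans (cong length (filter-++ (T? ∘ q) xs ys)) (length-++ (filterᵇ q xs))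

countᵇ-map : ∀ {A B : Set} (q : B → Bool) (f : A → B) xs → countᵇ q (map f xs) ≡ countᵇ (q ∘ f) xs
countᵇ-map q f []       = refl
countᵇ-map q f (x ∷ xs) with q (f x)
... | true  = cong suc (countᵇ-map q f xs)
... | false = countᵇ-map q f xs

countᵇ-subsets : ∀ m (q : Vec Bool m → Bool) → countᵇ q (subsets m) ≡ Σsub m (λ S → [ q S ]· 1)
countᵇ-subsets zero    q with q []
... | true  = refl
... | false = refl
countᵇ-subsets (suc m) q = begin
  countᵇ q (map (true ∷_) (subsets m) ++ map (false ∷_) (subsets m))
    ≡⟨ countᵇ-++ q (map (true ∷_) (subsets m)) _ ⟩
  countᵇ q (map (true ∷_) (subsets m)) + countᵇ q (map (false ∷_) (subsets m))
    ≡⟨ cong₂ _+_ (countᵇ-map q (true ∷_) (subsets m)) (countᵇ-map q (false ∷_) (subsets m)) ⟩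
  countᵇ (q ∘ (true ∷_)) (subsets m) + countᵇ (q ∘ (false ∷_)) (subsets m)
    ≡⟨ cong₂ _+_ (countᵇ-subsets m (q ∘ (true ∷_))) (countᵇ-subsets m (q ∘ (false ∷_))) ⟩
  Σsub (suc m) (λ S → [ q S ]· 1)
    ∎
  where open ≡-Reasoning

size-≤ : ∀ {m} (S : Vec Bool m) → size S ≤ m
size-≤ []          = z≤n
size-≤ (true  ∷ S) = s≤s (size-≤ S)
size-≤ (false ∷ S) = m≤n⇒m≤1+n (size-≤ S)


empty⇒none : ∀ {m} (S : Vec Bool m) → isEmpty S ≡ true → ∀ i → lookup S i ≡ false
empty⇒none (false ∷ S) e zero    = refl
empty⇒none (false ∷ S) e (suc i) = empty⇒none S e i

nonempty⇒witness : ∀ {m} (S : Vec Bool m) → isEmpty S ≡ false → ∃ λ i → lookup S i ≡ true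
nonempty⇒witness (true  ∷ S) e = zero , refl
nonempty⇒witness (false ∷ S) e with nonempty⇒witness S e
... | i , Si = suc i , Si

lookup-insert : ∀ {m} (s : Vec Bool m) w u → lookup (s [ w ]≔ true) u ≡ (lookup s u ∨ does (u ≟ᶠ w))
lookup-insert s w u with u ≟ᶠ w
... | yes refl = trans (lookup∘update u s true) (sym (∨-zeroʳ (lookup s u)))
... | no  u≢w  = trans (lookup∘update′ u≢w s true) (sym (∨-identityʳ (lookup s u)))

size-insert : ∀ {m} (s : Vec Bool m) w → lookup s w ≡ false → size (s [ w ]≔ true) ≡ suc (size s)
size-insert (false ∷ s) zero    e = refl
size-insert (true  ∷ s) (suc w) e = cong suc (size-insert s w e)
size-insert (false ∷ s) (suc w) e = size-insert s w e

size-++ : ∀ {m k} (s : Vec Bool m) (t : Vec Bool k) → size (s ++ᵛ t) ≡ size s + size t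
size-++ []          t = refl
size-++ (true  ∷ s) t = cong suc (size-++ s t)
size-++ (false ∷ s) t = size-++ s t

Σ1to-cong : ∀ m {f g : ℕ → ℕ} → (∀ i → f i ≡ g i) → Σ1to m f ≡ Σ1to m g
Σ1to-cong zero    h = refl
Σ1to-cong (suc m) h = cong₂ _+_ (Σ1to-cong m h) (h (suc m))

Σ1to-+ : ∀ m (f g : ℕ → ℕ) → Σ1to m (λ i → f i + g i) ≡ Σ1to m f + Σ1to m g
Σ1to-+ zero    f g = refl
Σ1to-+ (suc m) f g = trans (cong (_+ (f (suc m) + g (suc m))) (Σ1to-+ m f g))
                           (interchange (Σ1to m f) (Σ1to m g) (f (suc m)) (g (suc m)))

Σ1to-zero : ∀ m → Σ1to m (λ _ → 0) ≡ 0
Σ1to-zero zero    = refl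
Σ1to-zero (suc m) = cong (_+ 0) (Σ1to-zero m)

Σ1to-[]· : ∀ m b (f : ℕ → ℕ) → Σ1to m (λ i → [ b ]· f i) ≡ [ b ]· Σ1to m f
Σ1to-[]· m true  f = refl
Σ1to-[]· m false f = Σ1to-zero m

Σsub-Σ1to : ∀ k m (F : Vec Bool k → ℕ → ℕ) →
            Σsub k (λ S → Σ1to m (F S)) ≡ Σ1to m (λ i → Σsub k (λ S → F S i))
Σsub-Σ1to zero    m F = refl
Σsub-Σ1to (suc k) m F =
  trans (cong₂ _+_ (Σsub-Σ1to k m (F ∘ (true ∷_))) (Σsub-Σ1to k m (F ∘ (false ∷_))))
        (sym (Σ1to-+ m (λ i → Σsub k (λ S → F (true ∷ S) i)) (λ i → Σsub k (λ S → F (false ∷ S) i))))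

-- g on positive arguments, 0 at 0: the weight a size-k set receives in a
-- sum Σ_{i=1}^{m} that starts at index 1
positive : (ℕ → ℕ) → ℕ → ℕ
positive g zero    = 0
positive g (suc k) = g (suc k)

Σ1to-beyond : ∀ m k (g : ℕ → ℕ) → m < k → Σ1to m (λ i → [ k ≡ᵇ i ]· g i) ≡ 0
Σ1to-beyond zero    k g _  = refl
Σ1to-beyond (suc m) k g lt with k ≡ᵇ suc m in e
... | true  = ⊥-elim (<-irrefl (sym (≡ᵇ-sound k (suc m) e)) lt)
... | false = trans (+-identityʳ _) (Σ1to-beyond m k g (<-trans (n<1+n m) lt))

Σ1to-select : ∀ m k (g : ℕ → ℕ) → k ≤ m → Σ1to m (λ i → [ k ≡ᵇ i ]· g i) ≡ positive g k
Σ1to-select zero    zero g _ = refl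
Σ1to-select (suc m) k    g k≤ with k ≟ suc m
... | yes refl rewrite ≡ᵇ-refl m = cong (_+ g (suc m)) (Σ1to-beyond m (suc m) g (n<1+n m))
... | no  k≢ with k ≡ᵇ suc m in e
...   | true  = ⊥-elim (k≢ (≡ᵇ-sound k (suc m) e))
...   | false = trans (+-identityʳ _) (Σ1to-select m k g (≤-pred (≤∧≢⇒< k≤ k≢)))

Σ1to-p : ∀ G (g : ℕ → ℕ) →
         Σ1to (n G) (λ i → p G i * g i)
         ≡ Σsub (n G) (λ S → [ isPowerDominating G (lookup S) ]· positive g (size S))
Σ1to-p G g = begin
  Σ1to (n G) (λ i → p G i * g i)
    ≡⟨ Σ1to-cong (n G) (λ i → cong (_* g i) (countᵇ-subsets (n G) _)) ⟩
  Σ1to (n G) (λ i → Σsub (n G) (λ S → [ PD S ∧ (size S ≡ᵇ i) ]· 1) * g i)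
    ≡⟨ Σ1to-cong (n G) (λ i → trans (sym (Σsub-*ʳ (n G) (g i) _)) (Σsub-cong (n G) (weight i))) ⟩
  Σ1to (n G) (λ i → Σsub (n G) (λ S → [ PD S ]· [ size S ≡ᵇ i ]· g i))
    ≡⟨ sym (Σsub-Σ1to (n G) (n G) (λ S i → [ PD S ]· [ size S ≡ᵇ i ]· g i)) ⟩
  Σsub (n G) (λ S → Σ1to (n G) (λ i → [ PD S ]· [ size S ≡ᵇ i ]· g i))
    ≡⟨ Σsub-cong (n G) (λ S → trans (Σ1to-[]· (n G) (PD S) _)
                                    (cong ([ PD S ]·_) (Σ1to-select (n G) (size S) g (size-≤ S)))) ⟩
  Σsub (n G) (λ S → [ PD S ]· positive g (size S))
    ∎
  where
  open ≡-Reasoning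
  PD : Vec Bool (n G) → Bool
  PD S = isPowerDominating G (lookup S)
  weight : ∀ i S → [ PD S ∧ (size S ≡ᵇ i) ]· 1 * g i ≡ [ PD S ]· [ size S ≡ᵇ i ]· g i
  weight i S = trans ([]·-one (PD S ∧ (size S ≡ᵇ i)) (g i)) ([]·-∧ (PD S) _ (g i))

module Closure (H : Graph) where

  Vertex : Set
  Vertex = Fin (n H)

  Coloring : Set
  Coloring = Vertex → Bool

  _⊆_ : Coloring → Coloring → Set
  C ⊆ D = ∀ u → C u ≡ true → D u ≡ true

  uncolored : Coloring → Vertex → ℕ
  uncolored C v = count (λ u → adj H v u ∧ not (C u))

  uncoloredTotal : Coloring → ℕ
  uncoloredTotal C = count (not ∘ C)

  uncoloredNbrs≡ : ∀ C v → uncoloredNbrs H C v ≡ uncolored C v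
  uncoloredNbrs≡ C v = countᵇ-tabulate (λ u → adj H v u ∧ not (C u)) (λ u → u)

  uncolored-anti : ∀ {C D} → C ⊆ D → ∀ v → uncolored D v ≤ uncolored C v
  uncolored-anti C⊆D v = count-mono (λ u e → ∧-true (∧-trueˡ e) (not-mono (C⊆D u) (∧-trueʳ {adj H v u} e)))

  uncolored-pos : ∀ C {v u} → adj H v u ≡ true → C u ≡ false → 1 ≤ uncolored C v
  uncolored-pos C {v} {u} vu cu = count-pos _ u (∧-true vu (not-false cu))

  uncolored-one : ∀ {C D} → C ⊆ D → ∀ {v u} → adj H v u ≡ true → D u ≡ false →
                  uncolored C v ≡ 1 → uncolored D v ≡ 1
  uncolored-one {C} {D} C⊆D vu du one =
    ≤-antisym (≤-trans (uncolored-anti C⊆D _) (≤-reflexive one)) (uncolored-pos D vu du)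

  forceStep-intro : ∀ C u v → C v ≡ true → adj H v u ≡ true → uncolored C v ≡ 1 → forceStep H C u ≡ true
  forceStep-intro C u v cv vu one = ∨-trueʳ (C u) _ (any⁺ _ (∈-allFin v) (∧-true cv (∧-true vu single)))
    where
    single : (uncoloredNbrs H C v ≡ᵇ 1) ≡ true
    single rewrite uncoloredNbrs≡ C v | one = refl

  forceStep-elim : ∀ C u → forceStep H C u ≡ true →
                   C u ≡ true ⊎ ∃ λ v → C v ≡ true × adj H v u ≡ true × uncolored C v ≡ 1
  forceStep-elim C u e with ∨-true-elim (C u) _ e
  ... | inj₁ cu = inj₁ cu
  ... | inj₂ forced with any⁻ (λ v → C v ∧ adj H v u ∧ (uncoloredNbrs H C v ≡ᵇ 1)) (allFin (n H)) forced
  ...   | v , w = inj₂ (v , ∧-trueˡ w , ∧-trueˡ (∧-trueʳ {C v} w) ,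
                        trans (sym (uncoloredNbrs≡ C v)) (≡ᵇ-sound _ 1 (∧-trueʳ {adj H v u} (∧-trueʳ {C v} w))))

  forceStep-⊇ : ∀ C → C ⊆ forceStep H C
  forceStep-⊇ C u = ∨-trueˡ (C u) _

  forceStep-cong : ∀ {C D} → C ≗ D → forceStep H C ≗ forceStep H D
  forceStep-cong {C} {D} C≗D u = cong₂ _∨_ (C≗D u) (any-cong (allFin (n H)) λ v →
    cong₂ _∧_ (C≗D v) (cong (λ k → adj H v u ∧ (k ≡ᵇ 1)) (begin
      uncoloredNbrs H C v ≡⟨ uncoloredNbrs≡ C v ⟩
      uncolored C v       ≡⟨ count-cong (λ w → cong (λ b → adj H v w ∧ not b) (C≗D w)) ⟩
      uncolored D v       ≡⟨ uncoloredNbrs≡ D v ⟨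
      uncoloredNbrs H D v ∎)))
    where open ≡-Reasoning

  domStep-self : ∀ S u → S u ≡ true → domStep H S u ≡ true
  domStep-self S u = ∨-trueˡ (S u) _

  domStep-nbr : ∀ S u v → S v ≡ true → adj H v u ≡ true → domStep H S u ≡ true
  domStep-nbr S u v sv vu = ∨-trueʳ (S u) _ (any⁺ _ (∈-allFin v) (∧-true sv vu))

  domStep-elim : ∀ S u → domStep H S u ≡ true → S u ≡ true ⊎ ∃ λ v → S v ≡ true × adj H v u ≡ true
  domStep-elim S u e with ∨-true-elim (S u) _ e
  ... | inj₁ su = inj₁ su
  ... | inj₂ dominated with any⁻ (λ v → S v ∧ adj H v u) (allFin (n H)) dominated
  ...   | v , w = inj₂ (v , ∧-trueˡ w , ∧-trueʳ {S v} w)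

  domStep-cong : ∀ {S T} → S ≗ T → domStep H S ≗ domStep H T
  domStep-cong S≗T u = cong₂ _∨_ (S≗T u) (any-cong (allFin (n H)) (λ v → cong (_∧ adj H v u) (S≗T v)))

  iterate-cong : ∀ k {C D} → C ≗ D → iterateN H k C ≗ iterateN H k D
  iterate-cong zero    C≗D = C≗D
  iterate-cong (suc k) C≗D = iterate-cong k (forceStep-cong C≗D)

  iterate-⊇ : ∀ k C → C ⊆ iterateN H k C
  iterate-⊇ zero    C u e = e
  iterate-⊇ (suc k) C u e = iterate-⊇ k (forceStep H C) u (forceStep-⊇ C u e)

  iterate-≤ : ∀ {k l} C → k ≤ l → iterateN H k C ⊆ iterateN H l C
  iterate-≤ {zero}  {l}     C _         = iterate-⊇ l C
  iterate-≤ {suc k} {suc l} C (s≤s k≤l) = iterate-≤ (forceStep H C) k≤l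

  iterate-+ : ∀ k l C → iterateN H (k + l) C ≡ iterateN H l (iterateN H k C)
  iterate-+ zero    l C = refl
  iterate-+ (suc k) l C = iterate-+ k l (forceStep H C)

  Fixed : Coloring → Set
  Fixed C = forceStep H C ≗ C

  Fixed-cong : ∀ {C D} → C ≗ D → Fixed C → Fixed D
  Fixed-cong C≗D fixed u = trans (sym (forceStep-cong C≗D u)) (trans (fixed u) (C≗D u))

  Fixed-iterate : ∀ k C → Fixed C → iterateN H k C ≗ C
  Fixed-iterate zero    C fixed u = refl
  Fixed-iterate (suc k) C fixed u = trans (iterate-cong k fixed u) (Fixed-iterate k C fixed u)

  Fixed-no-force : ∀ {C} → Fixed C → ∀ u v → C v ≡ true → adj H v u ≡ true → uncolored C v ≡ 1 → C u ≡ true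
  Fixed-no-force {C} fixed u v cv vu one = trans (sym (fixed u)) (forceStep-intro C u v cv vu one)

  fixed-or-progress : ∀ C → Fixed C ⊎ uncoloredTotal (forceStep H C) < uncoloredTotal C
  fixed-or-progress C with uncoloredTotal (forceStep H C) <? uncoloredTotal C
  ... | yes progress = inj₂ progress
  ... | no  stuck    = inj₁ fixed
    where
    fixed : Fixed C
    fixed u with true-or-false (C u) | true-or-false (forceStep H C u)
    ... | inj₁ cu | inj₁ fu = trans fu (sym cu)
    ... | inj₂ cu | inj₂ fu = trans fu (sym cu)
    ... | inj₁ cu | inj₂ fu = ⊥-elim (true≢false (forceStep-⊇ C u cu) fu)
    ... | inj₂ cu | inj₁ fu = ⊥-elim (stuck (count-strict (λ w → not-mono (forceStep-⊇ C w)) u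
                                                     (cong not fu) (not-false cu)))

  stabilise : ∀ k C → uncoloredTotal C ≤ k → Fixed (iterateN H k C)
  stabilise zero C h u = trans (forceStep-⊇ C u colored) (sym colored)
    where
    colored : C u ≡ true
    colored = not-false⁻¹ (count-zero (not ∘ C) (n≤0⇒n≡0 h) u)
  stabilise (suc k) C h with fixed-or-progress C
  ... | inj₂ progress = stabilise k (forceStep H C) (≤-pred (≤-trans progress h))
  ... | inj₁ fixed    = Fixed-cong (λ u → sym (trans (iterate-cong k fixed u) (Fixed-iterate k C fixed u))) fixed

  iterate-invariant : (P : Coloring → Set) → (∀ C → P C → P (forceStep H C)) →
                      ∀ k C → P C → P (iterateN H k C)
  iterate-invariant P step zero    C pc = pc
  iterate-invariant P step (suc k) C pc = iterate-invariant P step k (forceStep H C) (step C pc)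

  final : Coloring → Coloring
  final = finalColored H

  final-Fixed : ∀ S → Fixed (final S)
  final-Fixed S = stabilise (n H) (domStep H S) (count-≤ _)

  dom⊆final : ∀ S → domStep H S ⊆ final S
  dom⊆final S = iterate-⊇ (n H) (domStep H S)

  S⊆final : ∀ S → S ⊆ final S
  S⊆final S u e = dom⊆final S u (domStep-self S u e)

  final-cong : ∀ {S T} → S ≗ T → final S ≗ final T
  final-cong S≗T = iterate-cong (n H) (domStep-cong S≗T)

  PD : Coloring → Bool
  PD = isPowerDominating H

  PD⇒colored : ∀ S → PD S ≡ true → ∀ u → final S u ≡ true
  PD⇒colored S e u = all⁻ (final S) e (∈-allFin u)

  colored⇒PD : ∀ S → (∀ u → final S u ≡ true) → PD S ≡ true
  colored⇒PD S h = all⁺ (final S) (allFin (n H)) h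

  uncolored⇒¬PD : ∀ S u → final S u ≡ false → PD S ≡ false
  uncolored⇒¬PD S u e with true-or-false (PD S)
  ... | inj₁ pd  = ⊥-elim (true≢false (PD⇒colored S pd u) e)
  ... | inj₂ ¬pd = ¬pd

  PD-cong : ∀ {S T} → S ≗ T → PD S ≡ PD T
  PD-cong S≗T = all-cong (allFin (n H)) (final-cong S≗T)

  final-empty : ∀ S → (∀ u → S u ≡ false) → ∀ u → final S u ≡ false
  final-empty S none = iterate-invariant (λ C → ∀ u → C u ≡ false) stuck (n H) (domStep H S) dom-empty
    where
    stuck : ∀ C → (∀ u → C u ≡ false) → ∀ u → forceStep H C u ≡ false
    stuck C none u rewrite none u =
      any-none _ (allFin (n H)) (λ v → cong (λ b → b ∧ adj H v u ∧ (uncoloredNbrs H C v ≡ᵇ 1)) (none v))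
    dom-empty : ∀ u → domStep H S u ≡ false
    dom-empty u rewrite none u = any-none _ (allFin (n H)) (λ v → cong (_∧ adj H v u) (none v))

  single-vertex-PD : n H ≡ 1 → ∀ S v → S v ≡ true → PD S ≡ true
  single-vertex-PD n≡1 S v Sv =
    colored⇒PD S (λ u → S⊆final S u (subst (λ y → S y ≡ true) (Fin1-unique n≡1 v u) Sv))

  almostPD : Coloring → Bool
  almostPD S = uncoloredTotal (final S) ≡ᵇ 1

  PD⇒¬almostPD : ∀ S → PD S ≡ true → almostPD S ≡ false
  PD⇒¬almostPD S pd rewrite count-none (not ∘ final S) (λ u → cong not (PD⇒colored S pd u)) = refl

  isolated : Vertex → Bool
  isolated w = not (any (adj H w) (allFin (n H)))

  isolated-adj : ∀ {w} → isolated w ≡ true → ∀ u → adj H u w ≡ false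
  isolated-adj {w} iso u with true-or-false (adj H w u)
  ... | inj₂ wu = trans (adj-sym H u w) wu
  ... | inj₁ wu = ⊥-elim (true≢false (any⁺ (adj H w) (∈-allFin u) wu) (not-true iso))

  isolated-adj′ : ∀ {w} → isolated w ≡ true → ∀ u → adj H w u ≡ false
  isolated-adj′ {w} iso u = trans (adj-sym H w u) (isolated-adj iso u)

  no-adj⇒isolated : ∀ w → (∀ u → adj H u w ≡ false) → isolated w ≡ true
  no-adj⇒isolated w h = not-false (any-none (adj H w) (allFin (n H)) (λ u → trans (adj-sym H w u) (h u)))

  final-isolated : ∀ {w} → isolated w ≡ true → ∀ S → S w ≡ false → final S w ≡ false
  final-isolated {w} iso S sw = iterate-invariant (λ C → C w ≡ false) stuck (n H) (domStep H S) dom-w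
    where
    stuck : ∀ C → C w ≡ false → forceStep H C w ≡ false
    stuck C cw rewrite cw = any-none _ (allFin (n H)) λ v →
      trans (cong (λ b → C v ∧ b ∧ (uncoloredNbrs H C v ≡ᵇ 1)) (isolated-adj iso v))
            (∧-zeroʳ-mid (C v) {uncoloredNbrs H C v ≡ᵇ 1})
    dom-w : domStep H S w ≡ false
    dom-w rewrite sw =
      any-none _ (allFin (n H)) (λ v → trans (cong (S v ∧_) (isolated-adj iso v)) (∧-zeroʳ (S v)))

  PD-isolated : ∀ S {w} → isolated w ≡ true → PD S ≡ true → S w ≡ true
  PD-isolated S {w} iso pd with true-or-false (S w)
  ... | inj₁ sw = sw
  ... | inj₂ sw = ⊥-elim (true≢false (PD⇒colored S pd w) (final-isolated iso S sw))

  _+ᵛ_ : Coloring → Vertex → Coloring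
  (C +ᵛ w) u = C u ∨ does (u ≟ᶠ w)

  -- an isolated vertex is nobody's uncoloured neighbour
  uncolored-insert : ∀ {w} → isolated w ≡ true → ∀ C v → uncolored (C +ᵛ w) v ≡ uncolored C v
  uncolored-insert {w} iso C v = count-cong same
    where
    same : ∀ u → adj H v u ∧ not (C u ∨ does (u ≟ᶠ w)) ≡ adj H v u ∧ not (C u)
    same u with u ≟ᶠ w
    ... | yes refl rewrite isolated-adj iso v = refl
    ... | no  _    = cong (λ b → adj H v u ∧ not b) (∨-identityʳ (C u))

  forceStep-insert : ∀ {w} → isolated w ≡ true → ∀ C → forceStep H (C +ᵛ w) ≗ (forceStep H C +ᵛ w)
  forceStep-insert {w} iso C u =
    trans (cong ((C u ∨ does (u ≟ᶠ w)) ∨_) (any-cong (allFin (n H)) forcer))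
          (xy∙z≈xz∙y (C u) (does (u ≟ᶠ w)) _)
    where
    forcer : ∀ v → (C v ∨ does (v ≟ᶠ w)) ∧ adj H v u ∧ (uncoloredNbrs H (C +ᵛ w) v ≡ᵇ 1)
                 ≡ C v ∧ adj H v u ∧ (uncoloredNbrs H C v ≡ᵇ 1)
    forcer v with v ≟ᶠ w
    ... | yes refl rewrite isolated-adj′ iso u =
      trans (∧-zeroʳ-mid (C v ∨ true) {uncoloredNbrs H (C +ᵛ v) v ≡ᵇ 1})
            (sym (∧-zeroʳ-mid (C v) {uncoloredNbrs H C v ≡ᵇ 1}))
    ... | no  _    rewrite ∨-identityʳ (C v) | uncoloredNbrs≡ (C +ᵛ w) v
                         | uncolored-insert iso C v | uncoloredNbrs≡ C v = refl

  domStep-insert : ∀ {w} → isolated w ≡ true → ∀ S → domStep H (S +ᵛ w) ≗ (domStep H S +ᵛ w)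
  domStep-insert {w} iso S u =
    trans (cong ((S u ∨ does (u ≟ᶠ w)) ∨_) (any-cong (allFin (n H)) dominator))
          (xy∙z≈xz∙y (S u) (does (u ≟ᶠ w)) _)
    where
    dominator : ∀ v → (S v ∨ does (v ≟ᶠ w)) ∧ adj H v u ≡ S v ∧ adj H v u
    dominator v with v ≟ᶠ w
    ... | yes refl rewrite isolated-adj′ iso u = trans (∧-zeroʳ (S v ∨ true)) (sym (∧-zeroʳ (S v)))
    ... | no  _    = cong (_∧ adj H v u) (∨-identityʳ (S v))

  iterate-insert : ∀ {w} → isolated w ≡ true → ∀ k C → iterateN H k (C +ᵛ w) ≗ (iterateN H k C +ᵛ w)
  iterate-insert iso zero    C u = refl
  iterate-insert iso (suc k) C u =
    trans (iterate-cong k (forceStep-insert iso C) u) (iterate-insert iso k (forceStep H C) u)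

  final-insert : ∀ {w} → isolated w ≡ true → ∀ S → final (S +ᵛ w) ≗ (final S +ᵛ w)
  final-insert iso S u =
    trans (iterate-cong (n H) (domStep-insert iso S) u) (iterate-insert iso (n H) (domStep H S) u)

  completes : Coloring → Vertex → Bool
  completes S w = isolated w ∧ not (S w) ∧ PD (S +ᵛ w)

  UniquelyUncolored : Coloring → Vertex → Set
  UniquelyUncolored S w = not (final S w) ≡ true × (∀ u → not (final S u) ≡ true → u ≡ w)

  completes⇒unique : ∀ S w → completes S w ≡ true → UniquelyUncolored S w
  completes⇒unique S w c = not-false (final-isolated iso S (not-true (∧-trueˡ c′))) , only-w
    where
    iso : isolated w ≡ true
    iso = ∧-trueˡ c
    c′ : not (S w) ∧ PD (S +ᵛ w) ≡ true
    c′ = ∧-trueʳ {isolated w} c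
    only-w : ∀ u → not (final S u) ≡ true → u ≡ w
    only-w u unc with u ≟ᶠ w
    ... | yes u≡w = u≡w
    ... | no  u≢w = ⊥-elim (true≢false colored (not-true unc))
      where
      colored : final S u ≡ true
      colored = trans (sym (∨-identityʳ (final S u)))
                 (trans (cong (final S u ∨_) (sym (dec-false (u ≟ᶠ w) u≢w)))
                 (trans (sym (final-insert iso S u)) (PD⇒colored (S +ᵛ w) (∧-trueʳ {not (S w)} c′) u)))

  unique⇒completes : ∀ S w → UniquelyUncolored S w → completes S w ≡ true
  unique⇒completes S w (unc-w , only-w) = ∧-true iso (∧-true (not-false S-w) completed)
    where
    final-w : final S w ≡ false
    final-w = not-true unc-w
    colored : ∀ u → ¬ (u ≡ w) → final S u ≡ true
    colored u u≢w with true-or-false (final S u)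
    ... | inj₁ fu = fu
    ... | inj₂ fu = ⊥-elim (u≢w (only-w u (not-false fu)))
    -- a neighbour of w would force it, as w is its only uncoloured neighbour
    no-nbr : ∀ u → adj H u w ≡ false
    no-nbr u with true-or-false (adj H u w)
    ... | inj₂ uw = uw
    ... | inj₁ uw = ⊥-elim (true≢false (Fixed-no-force (final-Fixed S) w u fu uw single) final-w)
      where
      u≢w : ¬ (u ≡ w)
      u≢w refl = true≢false uw (adj-irr H u)
      fu : final S u ≡ true
      fu = colored u u≢w
      single : uncolored (final S) u ≡ 1
      single = unique⇒count≡1 _ w (∧-true uw unc-w) (λ j e → only-w j (∧-trueʳ {adj H u j} e))
    iso : isolated w ≡ true
    iso = no-adj⇒isolated w no-nbr
    S-w : S w ≡ false
    S-w with true-or-false (S w)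
    ... | inj₁ sw = ⊥-elim (true≢false (S⊆final S w sw) final-w)
    ... | inj₂ sw = sw
    completed : PD (S +ᵛ w) ≡ true
    completed = colored⇒PD (S +ᵛ w) λ u → trans (final-insert iso S u) (or-w u)
      where
      or-w : ∀ u → final S u ∨ does (u ≟ᶠ w) ≡ true
      or-w u with u ≟ᶠ w
      ... | yes refl = ∨-trueʳ (final S u) true refl
      ... | no  u≢w  = ∨-trueˡ (final S u) false (colored u u≢w)

  count-completes : ∀ S → count (completes S) ≡ [ almostPD S ]· 1
  count-completes S with true-or-false (almostPD S)
  ... | inj₁ almost rewrite almost with count≡1⇒unique (not ∘ final S) (≡ᵇ-sound _ 1 almost)
  ...   | w , unique =
    unique⇒count≡1 (completes S) w (unique⇒completes S w unique)
                   (λ u c → proj₂ unique u (proj₁ (completes⇒unique S u c)))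
  count-completes S | inj₂ ¬almost rewrite ¬almost = count-none (completes S) none
    where
    none : ∀ w → completes S w ≡ false
    none w with true-or-false (completes S w)
    ... | inj₂ c = c
    ... | inj₁ c with completes⇒unique S w c
    ...   | unc-w , only-w =
      ⊥-elim (true≢false (cong (_≡ᵇ 1) (unique⇒count≡1 (not ∘ final S) w unc-w only-w)) ¬almost)

-- G contains an induced copy ι of H, and every other
-- vertex of G (the nonempty family κ) is adjacent to every vertex of the copy.
-- A set S of G meeting the copy in a nonempty set s and avoiding κ is power
-- dominating in G exactly when s is power dominating or almost power
-- dominating in H: after the domination step all of κ is coloured, the copy
-- then evolves as in H, and a vertex of κ forces only once a single vertex
-- of the copy remains uncoloured.
module JoinSide (G H : Graph) {k : ℕ}
    (ι : Fin (n H) → Fin (n G)) (κ : Fin k → Fin (n G)) (z₀ : Fin k)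
    (adj-ι : ∀ i j → adj G (ι i) (ι j) ≡ adj H i j)
    (adj-κι : ∀ z i → adj G (κ z) (ι i) ≡ true)
    (cover : ∀ u → (∃ λ i → u ≡ ι i) ⊎ (∃ λ z → u ≡ κ z))
    (count-ικ : ∀ (q : Fin (n G) → Bool) → count q ≡ count (q ∘ ι) + count (q ∘ κ))
  where

  module CG = Closure G
  module CH = Closure H

  adj-ικ : ∀ i z → adj G (ι i) (κ z) ≡ true
  adj-ικ i z = trans (adj-sym G (ι i) (κ z)) (adj-κι z i)

  n-G : n G ≡ n H + k
  n-G = begin
    n G                                          ≡⟨ count-all (λ _ → true) (λ _ → refl) ⟨
    count {n G} (λ _ → true)                     ≡⟨ count-ικ (λ _ → true) ⟩
    count {n H} (λ _ → true) + count {k} (λ _ → true)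
      ≡⟨ cong₂ _+_ (count-all {n H} (λ _ → true) (λ _ → refl)) (count-all {k} (λ _ → true) (λ _ → refl)) ⟩
    n H + k                                      ∎
    where open ≡-Reasoning

  κ-colored : CG.Coloring → Set
  κ-colored C = ∀ z → C (κ z) ≡ true

  count-copy-≤ : ∀ (C : CG.Coloring) (a : Fin (n G) → Bool) →
                 count (λ j → a (ι j) ∧ not (C (ι j))) ≤ count (λ u → a u ∧ not (C u))
  count-copy-≤ C a =
    ≤-trans (m≤m+n (count (λ j → a (ι j) ∧ not (C (ι j)))) (count (λ z → a (κ z) ∧ not (C (κ z)))))
            (≤-reflexive (sym (count-ικ (λ u → a u ∧ not (C u)))))

  count-copy : ∀ (C : CG.Coloring) → κ-colored C → ∀ (a : Fin (n G) → Bool) →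
               count (λ u → a u ∧ not (C u)) ≡ count (λ j → a (ι j) ∧ not (C (ι j)))
  count-copy C κ-col a = begin
    count (λ u → a u ∧ not (C u))
      ≡⟨ count-ικ (λ u → a u ∧ not (C u)) ⟩
    count (λ j → a (ι j) ∧ not (C (ι j))) + count (λ z → a (κ z) ∧ not (C (κ z)))
      ≡⟨ cong (count (λ j → a (ι j) ∧ not (C (ι j))) +_) (count-none _ κ-none) ⟩
    count (λ j → a (ι j) ∧ not (C (ι j))) + 0
      ≡⟨ +-identityʳ _ ⟩
    count (λ j → a (ι j) ∧ not (C (ι j)))
      ∎
    where
    open ≡-Reasoning
    κ-none : ∀ z → a (κ z) ∧ not (C (κ z)) ≡ false
    κ-none z = trans (cong (λ b → a (κ z) ∧ not b) (κ-col z)) (∧-zeroʳ (a (κ z)))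

  uncolored-ι : ∀ (C : CG.Coloring) v → κ-colored C → CG.uncolored C (ι v) ≡ CH.uncolored (C ∘ ι) v
  uncolored-ι C v κ-col = trans (count-copy C κ-col (adj G (ι v)))
                                (count-cong (λ j → cong (_∧ not (C (ι j))) (adj-ι v j)))

  uncolored-ι-≥ : ∀ (C : CG.Coloring) v → CH.uncolored (C ∘ ι) v ≤ CG.uncolored C (ι v)
  uncolored-ι-≥ C v = ≤-trans (≤-reflexive (count-cong (λ j → cong (_∧ not (C (ι j))) (sym (adj-ι v j)))))
                              (count-copy-≤ C (adj G (ι v)))

  uncolored-κ : ∀ (C : CG.Coloring) z → κ-colored C → CG.uncolored C (κ z) ≡ CH.uncoloredTotal (C ∘ ι)
  uncolored-κ C z κ-col = trans (count-copy C κ-col (adj G (κ z)))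
                                (count-cong (λ j → cong (_∧ not (C (ι j))) (adj-κι z j)))

  uncolored-κ-≥ : ∀ (C : CG.Coloring) z → CH.uncoloredTotal (C ∘ ι) ≤ CG.uncolored C (κ z)
  uncolored-κ-≥ C z = ≤-trans (≤-reflexive (count-cong (λ j → cong (_∧ not (C (ι j))) (sym (adj-κι z j)))))
                              (count-copy-≤ C (adj G (κ z)))

  Dominates : CG.Coloring → CH.Coloring → Set
  Dominates C c = κ-colored C × c CH.⊆ (C ∘ ι)

  dominates-step : ∀ (C : CG.Coloring) (c : CH.Coloring) →
                   Dominates C c → Dominates (forceStep G C) (forceStep H c)
  dominates-step C c (κ-col , c⊆C) = (λ z → CG.forceStep-⊇ C (κ z) (κ-col z)) , step
    where
    step : forceStep H c CH.⊆ (forceStep G C ∘ ι)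
    step i e with CH.forceStep-elim c i e | true-or-false (C (ι i))
    ... | _                          | inj₁ Ci = CG.forceStep-⊇ C (ι i) Ci
    ... | inj₁ ci                    | inj₂ Ci = ⊥-elim (true≢false (c⊆C i ci) Ci)
    ... | inj₂ (v , cv , vi , single) | inj₂ Ci =
      CG.forceStep-intro C (ι i) (ι v) (c⊆C v cv) (trans (adj-ι v i) vi)
        (trans (uncolored-ι C v κ-col) (CH.uncolored-one c⊆C vi Ci single))

  module _ (S : Fin (n G) → Bool) (s : Fin (n H) → Bool)
           (S-ι : ∀ i → S (ι i) ≡ s i) (S-κ : ∀ z → S (κ z) ≡ false) where

    -- if s is nonempty, κ is coloured by the domination step, and the runs stay in step
    dominates-iterate : ∀ i₀ → s i₀ ≡ true →
                        ∀ m → Dominates (iterateN G m (domStep G S)) (iterateN H m (domStep H s))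
    dominates-iterate i₀ si₀ m =
      go m (domStep G S) (domStep H s) (κ-dom , dom)
      where
      κ-dom : κ-colored (domStep G S)
      κ-dom z = CG.domStep-nbr S (κ z) (ι i₀) (trans (S-ι i₀) si₀) (adj-ικ i₀ z)
      dom : domStep H s CH.⊆ (domStep G S ∘ ι)
      dom i e with CH.domStep-elim s i e
      ... | inj₁ si           = CG.domStep-self S (ι i) (trans (S-ι i) si)
      ... | inj₂ (v , sv , vi) = CG.domStep-nbr S (ι i) (ι v) (trans (S-ι v) sv) (trans (adj-ι v i) vi)
      go : ∀ m (C : CG.Coloring) (c : CH.Coloring) →
           Dominates C c → Dominates (iterateN G m C) (iterateN H m c)
      go zero    C c d = d
      go (suc m) C c d = go m (forceStep G C) (forceStep H c) (dominates-step C c d)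

    -- if s leaves at most one vertex uncoloured in H, then S is power dominating:
    -- one round after the copy has caught up, κ forces the last vertex
    PD-if-≤1 : ∀ i₀ → s i₀ ≡ true → CH.uncoloredTotal (CH.final s) ≤ 1 → CG.PD S ≡ true
    PD-if-≤1 i₀ si₀ ≤1 = CG.colored⇒PD S colored
      where
      C : CG.Coloring
      C = iterateN G (n H) (domStep G S)
      κ-col : κ-colored C
      κ-col = proj₁ (dominates-iterate i₀ si₀ (n H))
      final⊆C : CH.final s CH.⊆ (C ∘ ι)
      final⊆C = proj₂ (dominates-iterate i₀ si₀ (n H))
      copy-colored : ∀ i → forceStep G C (ι i) ≡ true
      copy-colored i with true-or-false (C (ι i))
      ... | inj₁ Ci = CG.forceStep-⊇ C (ι i) Ci
      ... | inj₂ Ci =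
        CG.forceStep-intro C (ι i) (κ z₀) (κ-col z₀) (adj-κι z₀ i) (≤-antisym at-most-one at-least-one)
        where
        at-most-one : CG.uncolored C (κ z₀) ≤ 1
        at-most-one = ≤-trans (≤-reflexive (uncolored-κ C z₀ κ-col))
                              (≤-trans (count-mono (λ j → not-mono (final⊆C j))) ≤1)
        at-least-one : 1 ≤ CG.uncolored C (κ z₀)
        at-least-one = CG.uncolored-pos C (adj-κι z₀ i) Ci
      n-H+1≤ : n H + 1 ≤ n G
      n-H+1≤ = subst (n H + 1 ≤_) (sym n-G) (+-monoʳ-≤ (n H) (nonzero z₀))
        where
        nonzero : ∀ {m} → Fin m → 1 ≤ m
        nonzero zero    = s≤s z≤n
        nonzero (suc _) = s≤s z≤n
      colored : ∀ u → CG.final S u ≡ true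
      colored u with cover u
      ... | inj₁ (i , refl) =
        CG.iterate-≤ (domStep G S) n-H+1≤ (ι i)
          (subst (λ D → D (ι i) ≡ true) (sym (CG.iterate-+ (n H) 1 (domStep G S))) (copy-colored i))
      ... | inj₂ (z , refl) = proj₁ (dominates-iterate i₀ si₀ (n G)) z

    -- Upper bound: if s leaves two vertices uncoloured in H, the copy never gets
    -- beyond the final colouring of s, as κ never sees a single uncoloured vertex.
    ¬PD-if-≥2 : 2 ≤ CH.uncoloredTotal (CH.final s) → CG.PD S ≡ false
    ¬PD-if-≥2 ≥2 with count-witness (not ∘ CH.final s) (≤-trans (s≤s z≤n) ≥2)
    ... | i , unc-i = CG.uncolored⇒¬PD S (ι i) final-ι
      where
      Below : CG.Coloring → Set
      Below C = (C ∘ ι) CH.⊆ CH.final s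

      below-step : ∀ C → Below C → Below (forceStep G C)
      below-step C below j e with true-or-false (CH.final s j) | CG.forceStep-elim C (ι j) e
      ... | inj₁ fj | _       = fj
      ... | inj₂ fj | inj₁ Cj = below j Cj
      ... | inj₂ fj | inj₂ (v , Cv , vj , single) with cover v
      ...   | inj₁ (l , refl) = CH.Fixed-no-force (CH.final-Fixed s) j l (below l Cv) lj single-H
        where
        lj : adj H l j ≡ true
        lj = trans (sym (adj-ι l j)) vj
        single-H : CH.uncolored (CH.final s) l ≡ 1
        single-H = ≤-antisym
          (≤-trans (CH.uncolored-anti below l) (≤-trans (uncolored-ι-≥ C l) (≤-reflexive single)))
          (CH.uncolored-pos (CH.final s) lj fj)
      ...   | inj₂ (z , refl) = ⊥-elim (<-irrefl refl (≤-trans ≥2 κ-sees-≤1))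
        where
        -- κ z would see all ≥ 2 uncoloured copy vertices, yet it forces
        κ-sees-≤1 : CH.uncoloredTotal (CH.final s) ≤ 1
        κ-sees-≤1 = ≤-trans (count-mono (λ l → not-mono (below l)))
                            (≤-trans (uncolored-κ-≥ C z) (≤-reflexive single))

      below-dom : Below (domStep G S)
      below-dom j e with CG.domStep-elim S (ι j) e
      ... | inj₁ Sj = CH.S⊆final s j (trans (sym (S-ι j)) Sj)
      ... | inj₂ (v , Sv , vj) with cover v
      ...   | inj₁ (l , refl) =
        CH.dom⊆final s j (CH.domStep-nbr s j l (trans (sym (S-ι l)) Sv) (trans (sym (adj-ι l j)) vj))
      ...   | inj₂ (z , refl) = ⊥-elim (true≢false Sv (S-κ z))

      final-ι : CG.final S (ι i) ≡ false
      final-ι with true-or-false (CG.final S (ι i))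
      ... | inj₂ f = f
      ... | inj₁ f = ⊥-elim (true≢false below-final (not-true unc-i))
        where
        below-final : CH.final s i ≡ true
        below-final = CG.iterate-invariant Below below-step (n G) (domStep G S) below-dom i f

    side : ∀ i₀ → s i₀ ≡ true → CG.PD S ≡ (CH.PD s ∨ CH.almostPD s)
    side i₀ si₀ with CH.uncoloredTotal (CH.final s) in e
    ... | zero = trans (PD-if-≤1 i₀ si₀ (≤-trans (≤-reflexive e) z≤n)) (sym (cong (_∨ false) PD-s))
      where
      PD-s : CH.PD s ≡ true
      PD-s = CH.colored⇒PD s (λ u → not-false⁻¹ (count-zero (not ∘ CH.final s) e u))
    ... | suc zero = trans (PD-if-≤1 i₀ si₀ (≤-reflexive e)) (sym (∨-zeroʳ (CH.PD s)))
    ... | suc (suc m) =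
      trans (¬PD-if-≥2 (≤-trans (s≤s (s≤s z≤n)) (≤-reflexive (sym e)))) (sym (cong (_∨ false) ¬PD-s))
      where
      ¬PD-s : CH.PD s ≡ false
      ¬PD-s with count-witness (not ∘ CH.final s) (≤-trans (s≤s z≤n) (≤-reflexive (sym e)))
      ... | u , unc-u = CH.uncolored⇒¬PD s u (not-true unc-u)

some-vertex : ∀ {m} → 1 ≤ m → Fin m
some-vertex (s≤s _) = zero

module Join (G₁ G₂ : Graph) where

  G : Graph
  G = G₁ ∨ᴳ G₂

  n₁ n₂ : ℕ
  n₁ = n G₁
  n₂ = n G₂

  adj-ll : ∀ i j → adj G (i ↑ˡ n₂) (j ↑ˡ n₂) ≡ adj G₁ i j
  adj-ll i j rewrite splitAt-↑ˡ n₁ i n₂ | splitAt-↑ˡ n₁ j n₂ = refl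

  adj-rr : ∀ i j → adj G (n₁ ↑ʳ i) (n₁ ↑ʳ j) ≡ adj G₂ i j
  adj-rr i j rewrite splitAt-↑ʳ n₁ n₂ i | splitAt-↑ʳ n₁ n₂ j = refl

  adj-lr : ∀ i j → adj G (i ↑ˡ n₂) (n₁ ↑ʳ j) ≡ true
  adj-lr i j rewrite splitAt-↑ˡ n₁ i n₂ | splitAt-↑ʳ n₁ n₂ j = refl

  adj-rl : ∀ j i → adj G (n₁ ↑ʳ j) (i ↑ˡ n₂) ≡ true
  adj-rl j i rewrite splitAt-↑ˡ n₁ i n₂ | splitAt-↑ʳ n₁ n₂ j = refl

  cover : ∀ u → (∃ λ i → u ≡ i ↑ˡ n₂) ⊎ (∃ λ j → u ≡ n₁ ↑ʳ j)
  cover u with splitAt n₁ u in e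
  ... | inj₁ i = inj₁ (i , trans (sym (join-splitAt n₁ n₂ u)) (cong (join n₁ n₂) e))
  ... | inj₂ j = inj₂ (j , trans (sym (join-splitAt n₁ n₂ u)) (cong (join n₁ n₂) e))

  module Left = JoinSide G G₁ (_↑ˡ n₂) (n₁ ↑ʳ_) (some-vertex (nonempty G₂))
                  adj-ll adj-rl cover (count-split {n₁} {n₂})
  module Right = JoinSide G G₂ (n₁ ↑ʳ_) (_↑ˡ n₂) (some-vertex (nonempty G₁))
                  adj-rr adj-lr (swap ∘ cover)
                  (λ q → trans (count-split {n₁} {n₂} q) (+-comm (count (q ∘ (_↑ˡ n₂))) _))

  module CG = Closure G

  PD-left : ∀ (s : Vec Bool n₁) (t : Vec Bool n₂) → isEmpty t ≡ true → isEmpty s ≡ false →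
            CG.PD (lookup (s ++ᵛ t)) ≡ (Closure.PD G₁ (lookup s) ∨ Closure.almostPD G₁ (lookup s))
  PD-left s t t-empty s-nonempty with nonempty⇒witness s s-nonempty
  ... | i₀ , si₀ = Left.side (lookup (s ++ᵛ t)) (lookup s) (lookup-++ˡ s t)
                     (λ z → trans (lookup-++ʳ s t z) (empty⇒none t t-empty z)) i₀ si₀

  PD-right : ∀ (s : Vec Bool n₁) (t : Vec Bool n₂) → isEmpty s ≡ true → isEmpty t ≡ false →
             CG.PD (lookup (s ++ᵛ t)) ≡ (Closure.PD G₂ (lookup t) ∨ Closure.almostPD G₂ (lookup t))
  PD-right s t s-empty t-nonempty with nonempty⇒witness t t-nonempty
  ... | j₀ , tj₀ = Right.side (lookup (s ++ᵛ t)) (lookup t) (lookup-++ʳ s t)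
                     (λ z → trans (lookup-++ˡ s t z) (empty⇒none s s-empty z)) j₀ tj₀

  PD-both : ∀ (s : Vec Bool n₁) (t : Vec Bool n₂) → isEmpty s ≡ false → isEmpty t ≡ false →
            CG.PD (lookup (s ++ᵛ t)) ≡ true
  PD-both s t s-nonempty t-nonempty with nonempty⇒witness s s-nonempty | nonempty⇒witness t t-nonempty
  ... | i₀ , si₀ | j₀ , tj₀ = CG.colored⇒PD S (λ u → CG.dom⊆final S u (dominated u))
    where
    S : Fin (n₁ + n₂) → Bool
    S = lookup (s ++ᵛ t)
    dominated : ∀ u → domStep G S u ≡ true
    dominated u with cover u
    ... | inj₁ (i , refl) = CG.domStep-nbr S _ (n₁ ↑ʳ j₀) (trans (lookup-++ʳ s t j₀) tj₀) (adj-rl j₀ i)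
    ... | inj₂ (j , refl) = CG.domStep-nbr S _ (i₀ ↑ˡ n₂) (trans (lookup-++ˡ s t i₀) si₀) (adj-lr i₀ j)

module SideSum (H : Graph) (x : ℕ) where
  open Closure H

  -- the weight of s ∪ ∅ in 𝒫(G₁ ∨ G₂; x) when s is a subset of this side H
  contribution : Vec Bool (n H) → ℕ
  contribution s = [ not (isEmpty s) ∧ (PD (lookup s) ∨ almostPD (lookup s)) ]· x ^ size s

  contribution-split : ∀ s → contribution s ≡ [ PD (lookup s) ]· positive (x ^_) (size s)
                                            + [ not (isEmpty s) ∧ almostPD (lookup s) ]· x ^ size s
  contribution-split s with size s
  ... | zero = sym (trans (+-identityʳ _) ([]·-zero (PD (lookup s))))
  ... | suc k with PD (lookup s) in pd
  ...   | true  rewrite PD⇒¬almostPD (lookup s) pd = sym (+-identityʳ _)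
  ...   | false = refl

  -- the sets completed by the isolated vertex w, weighted by x^|s|, are the
  -- power dominating sets T ∋ w weighted by x^(|T|-1)
  completions-of : ∀ w → Σsub (n H) (λ s → [ completes (lookup s) w ]· x ^ size s)
                         ≡ [ isolated w ]· 𝒫/x H x
  completions-of w = begin
    Σsub (n H) (λ s → [ completes (lookup s) w ]· x ^ size s)
      ≡⟨ Σsub-cong (n H) removed ⟩
    Σsub (n H) (λ s → [ not (lookup s w) ]· weight (s [ w ]≔ true))
      ≡⟨ Σsub-insert (n H) w weight ⟨
    Σsub (n H) (λ T → [ lookup T w ]· weight T)
      ≡⟨ Σsub-cong (n H) contains-w ⟩
    Σsub (n H) (λ T → [ isolated w ]· [ PD (lookup T) ]· positive shifted (size T))
      ≡⟨ Σsub-[]· (n H) (isolated w) _ ⟩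
    [ isolated w ]· Σsub (n H) (λ T → [ PD (lookup T) ]· positive shifted (size T))
      ≡⟨ cong ([ isolated w ]·_) (Σ1to-p H shifted) ⟨
    [ isolated w ]· 𝒫/x H x
      ∎
    where
    open ≡-Reasoning
    shifted : ℕ → ℕ
    shifted i = x ^ (i ∸ 1)
    weight : Vec Bool (n H) → ℕ
    weight T = [ isolated w ]· [ PD (lookup T) ]· positive shifted (size T)
    removed : ∀ s → [ completes (lookup s) w ]· x ^ size s ≡ [ not (lookup s w) ]· weight (s [ w ]≔ true)
    removed s with lookup s w in sw
    ... | true  rewrite ∧-zeroʳ-mid (isolated w) {PD (lookup s +ᵛ w)} = refl
    ... | false rewrite size-insert s w sw | PD-cong (lookup-insert s w) =
      []·-∧ (isolated w) (PD (lookup s +ᵛ w)) (x ^ size s)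
    contains-w : ∀ T → [ lookup T w ]· weight T ≡ [ isolated w ]· [ PD (lookup T) ]· positive shifted (size T)
    contains-w T with isolated w in iso | PD (lookup T) in pd
    ... | false | _     = []·-zero (lookup T w)
    ... | true  | false = []·-zero (lookup T w)
    ... | true  | true  rewrite PD-isolated (lookup T) iso pd = refl

  almost-sum : Σsub (n H) (λ s → [ not (isEmpty s) ∧ almostPD (lookup s) ]· x ^ size s) ≡ I H * 𝒫/x H x
  almost-sum with n H ≡ᵇ 1 in n≡1
  ... | true = trans (Σsub-cong (n H) none) (Σsub-zero (n H))
    where
    none : ∀ s → [ not (isEmpty s) ∧ almostPD (lookup s) ]· x ^ size s ≡ 0
    none s with true-or-false (isEmpty s)
    ... | inj₁ e rewrite e = refl
    ... | inj₂ e with nonempty⇒witness s e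
    ...   | v , sv rewrite e | PD⇒¬almostPD (lookup s)
                                 (single-vertex-PD (≡ᵇ-sound (n H) 1 n≡1) (lookup s) v sv) = refl
  ... | false = begin
    Σsub (n H) (λ s → [ not (isEmpty s) ∧ almostPD (lookup s) ]· x ^ size s)
      ≡⟨ Σsub-cong (n H) drop-empty ⟩
    Σsub (n H) (λ s → [ almostPD (lookup s) ]· x ^ size s)
      ≡⟨ Σsub-cong (n H) (λ s → trans (sym ([]·-one _ (x ^ size s)))
                                     (trans (cong (_* x ^ size s) (sym (count-completes (lookup s))))
                                            (count-* (completes (lookup s)) (x ^ size s)))) ⟩
    Σsub (n H) (λ s → ∑[ w < n H ] ([ completes (lookup s) w ]· x ^ size s))
      ≡⟨ Σsub-∑ (n H) (λ s w → [ completes (lookup s) w ]· x ^ size s) ⟩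
    ∑[ w < n H ] Σsub (n H) (λ s → [ completes (lookup s) w ]· x ^ size s)
      ≡⟨ sum-cong-≗ completions-of ⟩
    ∑[ w < n H ] ([ isolated w ]· 𝒫/x H x)
      ≡⟨ count-* isolated (𝒫/x H x) ⟨
    count isolated * 𝒫/x H x
      ≡⟨ cong (_* 𝒫/x H x) (countᵇ-tabulate isolated (λ w → w)) ⟨
    isolatedCount H * 𝒫/x H x
      ∎
    where
    open ≡-Reasoning
    -- the empty set leaves all n ≠ 1 vertices uncoloured
    drop-empty : ∀ s → [ not (isEmpty s) ∧ almostPD (lookup s) ]· x ^ size s ≡ [ almostPD (lookup s) ]· x ^ size s
    drop-empty s with true-or-false (isEmpty s)
    ... | inj₂ e rewrite e = refl
    ... | inj₁ e rewrite e
                       | count-all (not ∘ final (lookup s))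
                           (λ u → not-false (final-empty (lookup s) (empty⇒none s e) u))
                       | n≡1 = refl

  side-sum : Σsub (n H) contribution ≡ 𝒫 H x + I H * 𝒫/x H x
  side-sum = begin
    Σsub (n H) contribution
      ≡⟨ Σsub-cong (n H) contribution-split ⟩
    Σsub (n H) (λ s → [ PD (lookup s) ]· positive (x ^_) (size s)
                      + [ not (isEmpty s) ∧ almostPD (lookup s) ]· x ^ size s)
      ≡⟨ Σsub-+ (n H) _ _ ⟩
    Σsub (n H) (λ s → [ PD (lookup s) ]· positive (x ^_) (size s))
      + Σsub (n H) (λ s → [ not (isEmpty s) ∧ almostPD (lookup s) ]· x ^ size s)
      ≡⟨ cong₂ _+_ (sym (Σ1to-p H (x ^_))) almost-sum ⟩
    𝒫 H x + I H * 𝒫/x H x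
      ∎
    where open ≡-Reasoning

module JoinSum (G₁ G₂ : Graph) (x : ℕ) where
  open Join G₁ G₂ public
  module S₁ = SideSum G₁ x
  module S₂ = SideSum G₂ x

  nonemptyWeight : ∀ {m} → Vec Bool m → ℕ
  nonemptyWeight s = [ not (isEmpty s) ]· x ^ size s

  join-weight : ∀ (s : Vec Bool n₁) (t : Vec Bool n₂) →
    [ CG.PD (lookup (s ++ᵛ t)) ]· positive (x ^_) (size (s ++ᵛ t))
    ≡ [ isEmpty t ]· S₁.contribution s + [ isEmpty s ]· S₂.contribution t
      + nonemptyWeight s * nonemptyWeight t
  join-weight s t rewrite size-++ s t with size s in s-size | size t in t-size
  ... | zero  | zero  = []·-zero _
  ... | suc a | zero  rewrite PD-left s t (cong (_≡ᵇ 0) t-size) (cong (_≡ᵇ 0) s-size)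
                            | +-identityʳ a | *-zeroʳ (x * x ^ a) = sym (trans (+-identityʳ _) (+-identityʳ _))
  ... | zero  | suc b rewrite PD-right s t (cong (_≡ᵇ 0) s-size) (cong (_≡ᵇ 0) t-size) = sym (+-identityʳ _)
  ... | suc a | suc b rewrite PD-both s t (cong (_≡ᵇ 0) s-size) (cong (_≡ᵇ 0) t-size) =
    ^-distribˡ-+-* x (suc a) (suc b)

  sum-over-t : ∀ (s : Vec Bool n₁) →
    Σsub n₂ (λ t → [ isEmpty t ]· S₁.contribution s + [ isEmpty s ]· S₂.contribution t
                   + nonemptyWeight s * nonemptyWeight t)
    ≡ S₁.contribution s + [ isEmpty s ]· Σsub n₂ S₂.contribution
      + nonemptyWeight s * Σsub n₂ nonemptyWeight
  sum-over-t s = begin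
    Σsub n₂ (λ t → [ isEmpty t ]· S₁.contribution s + [ isEmpty s ]· S₂.contribution t
                   + nonemptyWeight s * nonemptyWeight t)
      ≡⟨ Σsub-+ n₂ _ _ ⟩
    Σsub n₂ (λ t → [ isEmpty t ]· S₁.contribution s + [ isEmpty s ]· S₂.contribution t)
      + Σsub n₂ (λ t → nonemptyWeight s * nonemptyWeight t)
      ≡⟨ cong₂ _+_ (Σsub-+ n₂ _ _) (Σsub-*ˡ n₂ (nonemptyWeight s) nonemptyWeight) ⟩
    Σsub n₂ (λ t → [ isEmpty t ]· S₁.contribution s) + Σsub n₂ (λ t → [ isEmpty s ]· S₂.contribution t)
      + nonemptyWeight s * Σsub n₂ nonemptyWeight
      ≡⟨ cong (_+ nonemptyWeight s * Σsub n₂ nonemptyWeight)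
              (cong₂ _+_ (Σsub-empty n₂ (S₁.contribution s)) (Σsub-[]· n₂ (isEmpty s) S₂.contribution)) ⟩
    S₁.contribution s + [ isEmpty s ]· Σsub n₂ S₂.contribution + nonemptyWeight s * Σsub n₂ nonemptyWeight
      ∎
    where open ≡-Reasoning

  sum-over-s : Σsub n₁ (λ s → S₁.contribution s + [ isEmpty s ]· Σsub n₂ S₂.contribution
                              + nonemptyWeight s * Σsub n₂ nonemptyWeight)
               ≡ Σsub n₁ S₁.contribution + Σsub n₂ S₂.contribution
                 + Σsub n₁ nonemptyWeight * Σsub n₂ nonemptyWeight
  sum-over-s = begin
    Σsub n₁ (λ s → S₁.contribution s + [ isEmpty s ]· Σsub n₂ S₂.contribution
                   + nonemptyWeight s * Σsub n₂ nonemptyWeight)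
      ≡⟨ Σsub-+ n₁ _ _ ⟩
    Σsub n₁ (λ s → S₁.contribution s + [ isEmpty s ]· Σsub n₂ S₂.contribution)
      + Σsub n₁ (λ s → nonemptyWeight s * Σsub n₂ nonemptyWeight)
      ≡⟨ cong₂ _+_ (trans (Σsub-+ n₁ _ _) (cong (Σsub n₁ S₁.contribution +_) (Σsub-empty n₁ _)))
                   (Σsub-*ʳ n₁ (Σsub n₂ nonemptyWeight) nonemptyWeight) ⟩
    Σsub n₁ S₁.contribution + Σsub n₂ S₂.contribution + Σsub n₁ nonemptyWeight * Σsub n₂ nonemptyWeight
      ∎
    where open ≡-Reasoning

theorem18 : (G₁ G₂ : Graph) (x : ℕ) →
    𝒫 (G₁ ∨ᴳ G₂) x ≡
      (𝒫 G₁ x + I G₁ * 𝒫/x G₁ x)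
      + (𝒫 G₂ x + I G₂ * 𝒫/x G₂ x)
      + ((x + 1) ^ n G₁ ∸ 1) * ((x + 1) ^ n G₂ ∸ 1)
theorem18 G₁ G₂ x = begin
  𝒫 G x
    ≡⟨ Σ1to-p G (x ^_) ⟩
  Σsub (n₁ + n₂) (λ S → [ CG.PD (lookup S) ]· positive (x ^_) (size S))
    ≡⟨ Σsub-split n₁ n₂ _ ⟩
  Σsub n₁ (λ s → Σsub n₂ (λ t → [ CG.PD (lookup (s ++ᵛ t)) ]· positive (x ^_) (size (s ++ᵛ t))))
    ≡⟨ Σsub-cong n₁ (λ s → trans (Σsub-cong n₂ (join-weight s)) (sum-over-t s)) ⟩
  Σsub n₁ (λ s → S₁.contribution s + [ isEmpty s ]· Σsub n₂ S₂.contribution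
                 + nonemptyWeight s * Σsub n₂ nonemptyWeight)
    ≡⟨ sum-over-s ⟩
  Σsub n₁ S₁.contribution + Σsub n₂ S₂.contribution + Σsub n₁ nonemptyWeight * Σsub n₂ nonemptyWeight
    ≡⟨ cong₂ _+_ (cong₂ _+_ S₁.side-sum S₂.side-sum) (cong₂ _*_ (Σsub-nonempty n₁ x) (Σsub-nonempty n₂ x)) ⟩
  (𝒫 G₁ x + I G₁ * 𝒫/x G₁ x) + (𝒫 G₂ x + I G₂ * 𝒫/x G₂ x) + ((x + 1) ^ n₁ ∸ 1) * ((x + 1) ^ n₂ ∸ 1)
    ∎
  where
  open ≡-Reasoning
  open JoinSum G₁ G₂ x
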